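{- Let $H$ be an $r$-regular graph with at least one edge. Then $adv\text{ - }dern(H)=dern(H)=1$.
   Context: All graphs are finite, simple and undirected. For an edge $e=uv$, $d(e)=d(u)+d(v)-2$. A da-ecard of $G$ is a pair $(G-e,d(e))$ with $G-e$ the unlabelled edge-deleted subgraph; the da-edeck is the multiset of all da-ecards. $dern(G)$ is the minimum $k$ such that some multiset of $k$ da-ecards of $G$ is not contained in the da-edeck of any graph not isomorphic to $G$. $adv\text{ - }dern(G)$ is the least $k$ such that every multiset of $k$ da-ecards of $G$ is not contained in the da-edeck of any graph not isomorphic to $G$. -}

module Defs where

open import Data.Nat using (ℕ; zero; suc; _+_; _∸_; _<_)
open import Data.Bool using (Bool; true; false; if_then_else_; _∧_; _∨_; not)
open import Data.Fin using (Fin) renaming (_<_ to _<ᶠ_; _≟_ to _≟ᶠ_)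
open import Data.List using (List; map; allFin)
open import Data.Nat.ListAction using (sum)
open import Data.Product using (Σ; ∃; _×_; _,_; proj₁; proj₂)
open import Relation.Binary.PropositionalEquality using (_≡_)
open import Relation.Nullary using (¬_)
open import Relation.Nullary.Decidable using (⌊_⌋)
open import Function.Bundles using (_↔_; Inverse)

record Graph : Set where
  field
    n      : ℕ
    adj    : Fin n → Fin n → Bool
    sym    : ∀ i j → adj i j ≡ adj j i
    irrefl : ∀ i → adj i i ≡ false
open Graph public

Edge : Graph → Set
Edge G = Σ (Fin (n G) × Fin (n G)) λ p →
  (proj₁ p <ᶠ proj₂ p) × (adj G (proj₁ p) (proj₂ p) ≡ true)

endpoints : (G : Graph) → Edge G → Fin (n G) × Fin (n G)
endpoints G e = proj₁ e

deg : (G : Graph) → Fin (n G) → ℕ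
deg G u = sum (map (λ v → if adj G u v then 1 else 0) (allFin (n G)))

-- the number of edges adjacent to e = uv : d(u) + d(v) - 2
edeg : (G : Graph) → Edge G → ℕ
edeg G ((a , b) , _) = deg G a + deg G b ∸ 2

Iso : Graph → Graph → Set
Iso G H = Σ (Fin (n G) ↔ Fin (n H)) λ φ →
  ∀ i j → adj G i j ≡ adj H (Inverse.to φ i) (Inverse.to φ j)

_─_ : (G : Graph) → Edge G → Graph
G ─ ((a , b) , _) = record
  { n = n G
  ; adj = λ i j → adj G i j ∧ not (isE i j)
  ; sym = symP
  ; irrefl = irr
  }
  where
    isE : Fin (n G) → Fin (n G) → Bool
    isE i j = (⌊ i ≟ᶠ a ⌋ ∧ ⌊ j ≟ᶠ b ⌋) ∨ (⌊ i ≟ᶠ b ⌋ ∧ ⌊ j ≟ᶠ a ⌋)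
    ∨-comm : ∀ x y → (x ∨ y) ≡ (y ∨ x)
    ∨-comm false false = Relation.Binary.PropositionalEquality.refl
    ∨-comm false true = Relation.Binary.PropositionalEquality.refl
    ∨-comm true false = Relation.Binary.PropositionalEquality.refl
    ∨-comm true true = Relation.Binary.PropositionalEquality.refl
    ∧-comm : ∀ x y → (x ∧ y) ≡ (y ∧ x)
    ∧-comm false false = Relation.Binary.PropositionalEquality.refl
    ∧-comm false true = Relation.Binary.PropositionalEquality.refl
    ∧-comm true false = Relation.Binary.PropositionalEquality.refl
    ∧-comm true true = Relation.Binary.PropositionalEquality.refl
    open Relation.Binary.PropositionalEquality using (cong₂; trans)
    isE-sym : ∀ i j → isE i j ≡ isE j i
    isE-sym i j = trans (∨-comm (⌊ i ≟ᶠ a ⌋ ∧ ⌊ j ≟ᶠ b ⌋) (⌊ i ≟ᶠ b ⌋ ∧ ⌊ j ≟ᶠ a ⌋))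
      (cong₂ _∨_ (∧-comm ⌊ i ≟ᶠ b ⌋ ⌊ j ≟ᶠ a ⌋) (∧-comm ⌊ i ≟ᶠ a ⌋ ⌊ j ≟ᶠ b ⌋))
    symP : ∀ i j → (adj G i j ∧ not (isE i j)) ≡ (adj G j i ∧ not (isE j i))
    symP i j = cong₂ (λ x y → x ∧ not y) (Graph.sym G i j) (isE-sym i j)
    irr : ∀ i → (adj G i i ∧ not (isE i i)) ≡ false
    irr i = Relation.Binary.PropositionalEquality.cong (λ x → x ∧ not (isE i i)) (irrefl G i)

-- equality of da-ecards (G - e , d(e)) and (H - f , d(f)) as unlabelled objects
CardEq : (G : Graph) → Edge G → (H : Graph) → Edge H → Set
CardEq G e H f = Iso (G ─ e) (H ─ f) × (edeg G e ≡ edeg H f)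

InjE : {k : ℕ} (G : Graph) → (Fin k → Edge G) → Set
InjE {k} G s = ∀ (x y : Fin k) → endpoints G (s x) ≡ endpoints G (s y) → x ≡ y

-- a multiset of k da-ecards of H (a sub-multiset of its da-edeck)
SubDeck : Graph → ℕ → Set
SubDeck H k = Σ (Fin k → Edge H) (InjE H)

-- the multiset of cards chosen by s is contained in the da-edeck of G'
ContainedIn : (H : Graph) {k : ℕ} → SubDeck H k → Graph → Set
ContainedIn H {k} (s , _) G' = Σ (Fin k → Edge G') λ f →
  InjE G' f × (∀ x → CardEq G' (f x) H (s x))

Determines : (H : Graph) {k : ℕ} → SubDeck H k → Set
Determines H s = ∀ (G' : Graph) → ¬ Iso G' H → ¬ ContainedIn H s G'

IsDern : Graph → ℕ → Set
IsDern H k = (∃ λ (s : SubDeck H k) → Determines H s)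
           × (∀ j → j < k → ¬ (∃ λ (s : SubDeck H j) → Determines H s))

IsAdvDern : Graph → ℕ → Set
IsAdvDern H k = (∀ (s : SubDeck H k) → Determines H s)
              × (∀ j → j < k → ¬ (∀ (s : SubDeck H j) → Determines H s))

Regular : Graph → ℕ → Set
Regular G r = ∀ v → deg G v ≡ r

-- In H − ab every vertex has degree r except a and b, which have degree r − 1, so
-- d(ab) = 2r − 2 is the least value of deg x + deg y over pairs of vertices of H − ab.
-- If (G − uv, d(uv)) is the card of ab, then d(uv) is the sum of the degrees of u and v in
-- G − uv, hence an isomorphism G − uv ≅ H − ab must send {u, v} onto {a, b}; adding the
-- deleted edge back on both sides turns it into an isomorphism G ≅ H. So one card
-- already determines H, while the empty multiset of cards never does.
module Submission where

open import Defs hiding (sym)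
open import Data.Bool using (Bool; true; false; if_then_else_; _∧_; _∨_; not)
open import Data.Bool.Properties using (∨-comm; ∧-comm)
open import Data.Empty using (⊥; ⊥-elim)
open import Data.Fin using (Fin; zero; suc; _≟_) renaming (_<_ to _<ᶠ_)
open import Data.Fin.Permutation using (refute)
import Data.Fin.Properties as Fin
open import Data.List using (tabulate)
open import Data.List.Properties using (map-tabulate)
import Data.Nat.ListAction as List
open import Data.Nat using (ℕ; suc; _+_; _∸_; _≤_; _<_; z≤n; s≤s)
open import Data.Nat.Properties
  using (+-comm; +-suc; +-cancelˡ-≡; +-mono-≤; m≤n+m; m∸n+n≡m; 1+n≢n;
         +-commutativeSemigroup; +-0-commutativeMonoid)
open import Algebra.Properties.CommutativeSemigroup +-commutativeSemigroup using (interchange)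
open import Algebra.Properties.CommutativeMonoid.Sum +-0-commutativeMonoid
  using (sum-syntax; ∑-distrib-+; sum-cong-≗; sum-permute; sum-replicate-zero)
open import Data.Product using (∃; _×_; _,_; proj₁)
open import Data.Sum using (_⊎_; inj₁; inj₂)
open import Function.Base using (_∘_)
open import Function.Bundles using (Inverse; Injection; mk⇔)
open import Function.Properties.Inverse using (↔⇒↣)
open import Relation.Binary.PropositionalEquality
  using (_≡_; _≢_; refl; sym; trans; cong; cong₂; subst; module ≡-Reasoning)
open import Relation.Nullary using (¬_; yes; no)
open import Relation.Nullary.Decidable using (⌊_⌋; ⌊⌋-map′; isYes≗does; does-⇔)

[_] : Bool → ℕ
[ b ] = if b then 1 else 0

[]-partition : ∀ a p q → (p ≡ true → a ≡ true) → (q ≡ true → a ≡ true) →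
  (p ≡ true → q ≡ true → ⊥) → [ a ] ≡ [ a ∧ not (p ∨ q) ] + ([ p ] + [ q ])
[]-partition true  false false _  _  _  = refl
[]-partition true  false true  _  _  _  = refl
[]-partition true  true  false _  _  _  = refl
[]-partition true  true  true  _  _  pq = ⊥-elim (pq refl refl)
[]-partition false false false _  _  _  = refl
[]-partition false false true  _  q⇒a _ with () ← q⇒a refl
[]-partition false true  _     p⇒a _ _ with () ← p⇒a refl

∧≡true⇒ˡ : ∀ {p q} → p ∧ q ≡ true → p ≡ true
∧≡true⇒ˡ {true} _ = refl

∧-not-cancelʳ : ∀ a b f → a ∧ not f ≡ b ∧ not f →
  (f ≡ true → a ≡ true) → (f ≡ true → b ≡ true) → a ≡ b
∧-not-cancelʳ a     b     true  _  f⇒a f⇒b = trans (f⇒a refl) (sym (f⇒b refl))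
∧-not-cancelʳ true  true  false _  _   _   = refl
∧-not-cancelʳ false false false _  _   _   = refl

⌊≟⌋⇒≡ : ∀ {m} {x y : Fin m} → ⌊ x ≟ y ⌋ ≡ true → x ≡ y
⌊≟⌋⇒≡ {x = x} {y} eq with x ≟ y
... | yes x≡y = x≡y
⌊≟⌋⇒≡ () | no _

⌊≟⌋-refl : ∀ {m} (x : Fin m) → ⌊ x ≟ x ⌋ ≡ true
⌊≟⌋-refl x with x ≟ x
... | yes _ = refl
... | no x≢x = ⊥-elim (x≢x refl)

⌊≟⌋-≢ : ∀ {m} {x y : Fin m} → x ≢ y → ⌊ x ≟ y ⌋ ≡ false
⌊≟⌋-≢ {x = x} {y} x≢y with x ≟ y
... | yes x≡y = ⊥-elim (x≢y x≡y)
... | no _ = refl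

⌊≟⌋-injective : ∀ {m k} (f : Fin m → Fin k) → (∀ {i j} → f i ≡ f j → i ≡ j) →
  ∀ i j → ⌊ f i ≟ f j ⌋ ≡ ⌊ i ≟ j ⌋
⌊≟⌋-injective f f-inj i j =
  trans (isYes≗does (f i ≟ f j))
    (trans (does-⇔ (mk⇔ f-inj (cong f)) (f i ≟ f j) (i ≟ j)) (sym (isYes≗does (i ≟ j))))

listSum-tabulate : ∀ {m} (f : Fin m → ℕ) → List.sum (tabulate f) ≡ ∑[ i < m ] f i
listSum-tabulate {ℕ.zero} f = refl
listSum-tabulate {suc m}  f = cong (f zero +_) (listSum-tabulate (f ∘ suc))

∑-[≟] : ∀ {m} (b : Fin m) → ∑[ v < m ] [ ⌊ v ≟ b ⌋ ] ≡ 1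
∑-[≟] {suc m} zero    = cong suc (sum-replicate-zero m)
∑-[≟] {suc m} (suc b) = trans (sum-cong-≗ (λ v → cong [_] (⌊⌋-map′ _ _ (v ≟ b)))) (∑-[≟] b)

∑-[∧≟] : ∀ {m} p (b : Fin m) → ∑[ v < m ] [ p ∧ ⌊ v ≟ b ⌋ ] ≡ [ p ]
∑-[∧≟] {m} false b = sum-replicate-zero m
∑-[∧≟]     true  b = ∑-[≟] b

-- The test by which Defs._─_ deletes the edge ab, so that adj (G ─ ab) i j
-- reduces to adj G i j ∧ not (joins a b i j).
joins : ∀ {m} → Fin m → Fin m → Fin m → Fin m → Bool
joins a b i j = (⌊ i ≟ a ⌋ ∧ ⌊ j ≟ b ⌋) ∨ (⌊ i ≟ b ⌋ ∧ ⌊ j ≟ a ⌋)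

joins-comm : ∀ {m} (a b i j : Fin m) → joins b a i j ≡ joins a b i j
joins-comm a b i j = ∨-comm (⌊ i ≟ b ⌋ ∧ ⌊ j ≟ a ⌋) (⌊ i ≟ a ⌋ ∧ ⌊ j ≟ b ⌋)

joins-injective : ∀ {m k} (f : Fin m → Fin k) → (∀ {i j} → f i ≡ f j → i ≡ j) →
  ∀ a b i j → joins (f a) (f b) (f i) (f j) ≡ joins a b i j
joins-injective f f-inj a b i j =
  cong₂ _∨_ (cong₂ _∧_ (⌊≟⌋-injective f f-inj i a) (⌊≟⌋-injective f f-inj j b))
            (cong₂ _∧_ (⌊≟⌋-injective f f-inj i b) (⌊≟⌋-injective f f-inj j a))

module _ (G : Graph) {a b : Fin (n G)} (ab : adj G a b ≡ true) where

  adj-from-forward : ∀ i j → ⌊ i ≟ a ⌋ ∧ ⌊ j ≟ b ⌋ ≡ true → adj G i j ≡ true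
  adj-from-forward i j eq with ⌊ i ≟ a ⌋ in i≡a | ⌊ j ≟ b ⌋ in j≡b
  adj-from-forward i j refl | true | true
    rewrite ⌊≟⌋⇒≡ i≡a | ⌊≟⌋⇒≡ j≡b = ab

  adj-from-backward : ∀ i j → ⌊ i ≟ b ⌋ ∧ ⌊ j ≟ a ⌋ ≡ true → adj G i j ≡ true
  adj-from-backward i j eq =
    trans (Graph.sym G i j) (adj-from-forward j i (trans (∧-comm ⌊ j ≟ a ⌋ ⌊ i ≟ b ⌋) eq))

  joins⇒adj : ∀ i j → joins a b i j ≡ true → adj G i j ≡ true
  joins⇒adj i j eq with ⌊ i ≟ a ⌋ ∧ ⌊ j ≟ b ⌋ in fwd
  ... | true  = adj-from-forward i j fwd
  ... | false = adj-from-backward i j eq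

incidence : ∀ {m} → Fin m → Fin m → Fin m → ℕ
incidence a b x = [ ⌊ x ≟ a ⌋ ] + [ ⌊ x ≟ b ⌋ ]

deg≡∑ : (G : Graph) (u : Fin (n G)) → deg G u ≡ ∑[ v < n G ] [ adj G u v ]
deg≡∑ G u = trans (cong List.sum (map-tabulate (λ v → v) edge-count)) (listSum-tabulate edge-count)
  where edge-count : Fin (n G) → ℕ
        edge-count v = [ adj G u v ]

deg-Iso : ∀ {G H} (iso : Iso G H) i → deg G i ≡ deg H (Inverse.to (proj₁ iso) i)
deg-Iso {G} {H} (φ , pres) i = begin
  deg G i                              ≡⟨ deg≡∑ G i ⟩
  ∑[ j < n G ] [ adj G i j ]           ≡⟨ sum-cong-≗ (cong [_] ∘ pres i) ⟩
  ∑[ j < n G ] [ adj H (to i) (to j) ] ≡⟨ sum-permute _ φ ⟨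
  ∑[ k < n H ] [ adj H (to i) k ]      ≡⟨ deg≡∑ H (to i) ⟨
  deg H (to i)                         ∎
  where open ≡-Reasoning
        to = Inverse.to φ

deg-─ : (G : Graph) {a b : Fin (n G)} (a<b : a <ᶠ b) (ab : adj G a b ≡ true) →
  ∀ x → deg G x ≡ deg (G ─ ((a , b) , a<b , ab)) x + incidence a b x
deg-─ G {a} {b} a<b ab x = begin
  deg G x
    ≡⟨ deg≡∑ G x ⟩
  ∑[ v < n G ] [ adj G x v ]
    ≡⟨ sum-cong-≗ split ⟩
  ∑[ v < n G ] (kept v + ([ fwd v ] + [ bwd v ]))
    ≡⟨ ∑-distrib-+ kept (λ v → [ fwd v ] + [ bwd v ]) ⟩
  ∑[ v < n G ] kept v + ∑[ v < n G ] ([ fwd v ] + [ bwd v ])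
    ≡⟨ cong (∑[ v < n G ] kept v +_) (∑-distrib-+ (λ v → [ fwd v ]) (λ v → [ bwd v ])) ⟩
  ∑[ v < n G ] kept v + (∑[ v < n G ] [ fwd v ] + ∑[ v < n G ] [ bwd v ])
    ≡⟨ cong (∑[ v < n G ] kept v +_) (cong₂ _+_ (∑-[∧≟] _ b) (∑-[∧≟] _ a)) ⟩
  ∑[ v < n G ] kept v + incidence a b x
    ≡⟨ cong (_+ incidence a b x) (deg≡∑ G−ab x) ⟨
  deg G−ab x + incidence a b x
    ∎
  where
  open ≡-Reasoning
  G−ab = G ─ ((a , b) , a<b , ab)
  fwd bwd : Fin (n G) → Bool
  fwd v = ⌊ x ≟ a ⌋ ∧ ⌊ v ≟ b ⌋
  bwd v = ⌊ x ≟ b ⌋ ∧ ⌊ v ≟ a ⌋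
  kept : Fin (n G) → ℕ
  kept v = [ adj G x v ∧ not (joins a b x v) ]
  split : ∀ v → [ adj G x v ] ≡ kept v + ([ fwd v ] + [ bwd v ])
  split v = []-partition (adj G x v) (fwd v) (bwd v)
    (adj-from-forward G ab x v) (adj-from-backward G ab x v)
    (λ x≡a x≡b → Fin.<⇒≢ a<b
      (trans (sym (⌊≟⌋⇒≡ (∧≡true⇒ˡ {⌊ x ≟ a ⌋} x≡a))) (⌊≟⌋⇒≡ (∧≡true⇒ˡ {⌊ x ≟ b ⌋} x≡b))))

incidence≤1 : ∀ {m} {a b : Fin m} → a ≢ b → ∀ x → incidence a b x ≤ 1
incidence≤1 {a = a} {b} a≢b x with x ≟ a | x ≟ b
... | yes x≡a | yes x≡b = ⊥-elim (a≢b (trans (sym x≡a) x≡b))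
... | yes _   | no _    = s≤s z≤n
... | no _    | yes _   = s≤s z≤n
... | no _    | no _    = z≤n

incidence≡1⇒endpoint : ∀ {m} {a b : Fin m} x → incidence a b x ≡ 1 → x ≡ a ⊎ x ≡ b
incidence≡1⇒endpoint {a = a} {b} x eq with x ≟ a | x ≟ b
... | yes x≡a | _       = inj₁ x≡a
... | no _    | yes x≡b = inj₂ x≡b
incidence≡1⇒endpoint x () | no _ | no _

incidence-left : ∀ {m} {a b : Fin m} → a ≢ b → incidence a b a ≡ 1
incidence-left {a = a} a≢b = cong₂ (λ p q → [ p ] + [ q ]) (⌊≟⌋-refl a) (⌊≟⌋-≢ a≢b)

incidence-right : ∀ {m} {a b : Fin m} → a ≢ b → incidence a b b ≡ 1
incidence-right {b = b} a≢b = cong₂ (λ p q → [ p ] + [ q ]) (⌊≟⌋-≢ (a≢b ∘ sym)) (⌊≟⌋-refl b)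

edeg≡deg-─ : (G : Graph) {a b : Fin (n G)} (a<b : a <ᶠ b) (ab : adj G a b ≡ true) →
  let G−ab = G ─ ((a , b) , a<b , ab) in
  edeg G ((a , b) , a<b , ab) ≡ deg G−ab a + deg G−ab b
edeg≡deg-─ G {a} {b} a<b ab = begin
  deg G a + deg G b ∸ 2
    ≡⟨ cong₂ (λ p q → p + q ∸ 2) (deg-─ G a<b ab a) (deg-─ G a<b ab b) ⟩
  (X + incidence a b a) + (Y + incidence a b b) ∸ 2
    ≡⟨ cong₂ (λ p q → (X + p) + (Y + q) ∸ 2) (incidence-left a≢b) (incidence-right a≢b) ⟩
  (X + 1) + (Y + 1) ∸ 2
    ≡⟨ cong₂ (λ p q → p + q ∸ 2) (+-comm X 1) (+-comm Y 1) ⟩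
  X + suc Y ∸ 1
    ≡⟨ cong (_∸ 1) (+-suc X Y) ⟩
  X + Y
    ∎
  where
  open ≡-Reasoning
  a≢b = Fin.<⇒≢ a<b
  X = deg (G ─ ((a , b) , a<b , ab)) a
  Y = deg (G ─ ((a , b) , a<b , ab)) b

deficient-pair : ∀ {X Y c d r} → 1 ≤ r → c ≤ 1 → d ≤ 1 →
  X + c ≡ r → Y + d ≡ r → X + Y ≡ r + r ∸ 2 → c ≡ 1
deficient-pair {X} {Y} {c} {d} {r} 1≤r c≤1 d≤1 X+c≡r Y+d≡r X+Y≡ =
  both-one c≤1 d≤1 (+-cancelˡ-≡ (X + Y) (c + d) 2 sum≡)
  where
  open ≡-Reasoning
  sum≡ : X + Y + (c + d) ≡ X + Y + 2
  sum≡ = begin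
    X + Y + (c + d)    ≡⟨ interchange X Y c d ⟩
    (X + c) + (Y + d)  ≡⟨ cong₂ _+_ X+c≡r Y+d≡r ⟩
    r + r              ≡⟨ m∸n+n≡m (+-mono-≤ 1≤r 1≤r) ⟨
    r + r ∸ 2 + 2      ≡⟨ cong (_+ 2) X+Y≡ ⟨
    X + Y + 2          ∎
  both-one : ∀ {c d} → c ≤ 1 → d ≤ 1 → c + d ≡ 2 → c ≡ 1
  both-one (s≤s z≤n) _          _  = refl
  both-one z≤n       z≤n       ()
  both-one z≤n       (s≤s z≤n) ()

joins-endpoints : ∀ {m} {a b x y : Fin m} → x ≡ a ⊎ x ≡ b → y ≡ a ⊎ y ≡ b → x ≢ y →
  ∀ i j → joins x y i j ≡ joins a b i j
joins-endpoints (inj₁ refl) (inj₁ refl) x≢y _ _ = ⊥-elim (x≢y refl)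
joins-endpoints (inj₁ refl) (inj₂ refl) _   _ _ = refl
joins-endpoints (inj₂ refl) (inj₁ refl) _   i j = joins-comm _ _ i j
joins-endpoints (inj₂ refl) (inj₂ refl) x≢y _ _ = ⊥-elim (x≢y refl)

module _ (H : Graph) {r : ℕ} (reg : Regular H r)
         {a b : Fin (n H)} (a<b : a <ᶠ b) (ab : adj H a b ≡ true) where

  private
    H−ab = H ─ ((a , b) , a<b , ab)

  deg-─-regular : ∀ x → deg H−ab x + incidence a b x ≡ r
  deg-─-regular x = trans (sym (deg-─ H a<b ab x)) (reg x)

  deficient-pair-endpoint : ∀ x y → deg H−ab x + deg H−ab y ≡ r + r ∸ 2 → x ≡ a ⊎ x ≡ b
  deficient-pair-endpoint x y degs = incidence≡1⇒endpoint x
    (deficient-pair {deg H−ab x} {deg H−ab y} 1≤r (incidence≤1 a≢b x) (incidence≤1 a≢b y)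
      (deg-─-regular x) (deg-─-regular y) degs)
    where
    a≢b = Fin.<⇒≢ a<b
    1≤r : 1 ≤ r
    1≤r = subst (1 ≤_)
      (trans (cong (deg H−ab a +_) (sym (incidence-left a≢b))) (deg-─-regular a))
      (m≤n+m 1 (deg H−ab a))

cardEq⇒Iso : (H : Graph) {r : ℕ} → Regular H r →
  ∀ G (f : Edge G) (e : Edge H) → CardEq G f H e → Iso G H
cardEq⇒Iso H {r} reg G ((u , v) , u<v , uv) ((a , b) , a<b , ab) (iso@(φ , pres) , d≡) =
  φ , adj-preserved
  where
  open ≡-Reasoning
  to = Inverse.to φ
  to-injective : ∀ {i j} → to i ≡ to j → i ≡ j
  to-injective = Injection.injective (↔⇒↣ φ)
  G−uv = G ─ ((u , v) , u<v , uv)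
  H−ab = H ─ ((a , b) , a<b , ab)

  degs : deg H−ab (to u) + deg H−ab (to v) ≡ r + r ∸ 2
  degs = begin
    deg H−ab (to u) + deg H−ab (to v)
      ≡⟨ cong₂ _+_ (deg-Iso {G−uv} {H−ab} iso u) (deg-Iso {G−uv} {H−ab} iso v) ⟨
    deg G−uv u + deg G−uv v            ≡⟨ edeg≡deg-─ G u<v uv ⟨
    edeg G ((u , v) , u<v , uv)        ≡⟨ d≡ ⟩
    deg H a + deg H b ∸ 2              ≡⟨ cong₂ (λ p q → p + q ∸ 2) (reg a) (reg b) ⟩
    r + r ∸ 2                          ∎

  joins-image : ∀ i j → joins u v i j ≡ joins a b (to i) (to j)
  joins-image i j = begin
    joins u v i j                     ≡⟨ joins-injective to to-injective u v i j ⟨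
    joins (to u) (to v) (to i) (to j)
      ≡⟨ joins-endpoints to-u to-v (Fin.<⇒≢ u<v ∘ to-injective) (to i) (to j) ⟩
    joins a b (to i) (to j)           ∎
    where
    to-u = deficient-pair-endpoint H reg a<b ab (to u) (to v) degs
    to-v = deficient-pair-endpoint H reg a<b ab (to v) (to u) (trans (+-comm (deg H−ab (to v)) _) degs)

  adj-preserved : ∀ i j → adj G i j ≡ adj H (to i) (to j)
  adj-preserved i j = ∧-not-cancelʳ (adj G i j) (adj H (to i) (to j)) (joins a b (to i) (to j))
    (trans (cong (λ z → adj G i j ∧ not z) (sym (joins-image i j))) (pres i j))
    (joins⇒adj G uv i j ∘ trans (joins-image i j))
    (joins⇒adj H ab (to i) (to j))

regular⇒card-determines : (H : Graph) {r : ℕ} → Regular H r → (s : SubDeck H 1) → Determines H s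
regular⇒card-determines H reg (cards , _) G G≇H (f , _ , same) =
  G≇H (cardEq⇒Iso H reg G (f zero) (cards zero) (same zero))

single-card : (H : Graph) → Edge H → SubDeck H 1
single-card H e = (λ _ → e) , λ { zero zero _ → refl }

edgeless : ℕ → Graph
edgeless m = record { n = m ; adj = λ _ _ → false ; sym = λ _ _ → refl ; irrefl = λ _ → refl }

empty-subdeck-¬determines : (H : Graph) (s : SubDeck H 0) → ¬ Determines H s
empty-subdeck-¬determines H s determines =
  determines (edgeless (suc (n H))) (refute 1+n≢n ∘ proj₁) ((λ ()) , (λ ()) , (λ ()))

proposition4p1 : (H : Graph) (r : ℕ) → Regular H r → Edge H →
    IsAdvDern H 1 × IsDern H 1
proposition4p1 H r reg e =
  (regular⇒card-determines H reg , no-adv-dern-0) ,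
  ((single-card H e , regular⇒card-determines H reg (single-card H e)) , no-dern-0)
  where
  no-adv-dern-0 : ∀ j → j < 1 → ¬ (∀ (s : SubDeck H j) → Determines H s)
  no-adv-dern-0 .0 (s≤s z≤n) all-determine =
    empty-subdeck-¬determines H ((λ ()) , (λ ())) (all-determine ((λ ()) , (λ ())))
  no-dern-0 : ∀ j → j < 1 → ¬ (∃ λ (s : SubDeck H j) → Determines H s)
  no-dern-0 .0 (s≤s z≤n) (s , determines) = empty-subdeck-¬determines H s determines
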